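{- Let $\Gamma$ be a distance-regular graph with diameter $D\ge3$ and valency $k$. Let $\theta,\theta'$ be real numbers other than $k$ that form a tight pair. Then $$\Big(\theta+\frac{k}{a_1+1}\Big)\Big(\theta'+\frac{k}{a_1+1}\Big)=-\frac{k a_1 b_1}{(a_1+1)^2}.$$
   Context: $\Gamma$ is a finite, undirected, connected graph without loops or multiple edges, with path-length distance $\partial$ and diameter $D$. It is distance-regular: for all $0\le h,i,j\le D$ and all vertices $x,y$ with $\partial(x,y)=h$, the number $p^h_{ij}$ of vertices $z$ with $\partial(x,z)=i$, $\partial(y,z)=j$ depends only on $h,i,j$. Write $a_i=p^i_{1i}$, $b_i=p^i_{1,i+1}$ $(0\le i\le D-1)$, $c_i=p^i_{1,i-1}$ $(1\le i\le D)$, $c_0=0$, $b_D=0$, $k=b_0$. For $\theta\in\mathbb{R}$, the pseudo cosine sequence for $\theta$ is the sequence of reals $\sigma_0,\dots,\sigma_D$ with $\sigma_0=1$ and $c_i\sigma_{i-1}+a_i\sigma_i+b_i\sigma_{i+1}=\theta\sigma_i$ for $0\le i\le D-1$ (with $c_0\sigma_{ -1}=0$). Two pseudo cosine sequences $\sigma_i,\rho_i$ form a tight pair if $\sigma_0\rho_0,\dots,\sigma_D\rho_D$ is a pseudo cosine sequence; reals $\theta,\theta'$ form a tight pair if their pseudo cosine sequences do. -}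

module Defs where

open import Level using (0ℓ)
open import Data.Nat using (ℕ; zero; suc; _∸_; _<_) renaming (_≤_ to _≤ℕ_)
open import Data.Nat.Properties using (_≟_)
open import Data.Fin using (Fin)
open import Data.Sum using (_⊎_)
open import Data.List using (length; filter; allFin)
open import Data.Product using (Σ; ∃; _×_; _,_)
open import Relation.Nullary using (¬_)
open import Relation.Nullary.Decidable using (_×-dec_)
open import Relation.Binary.PropositionalEquality using (_≡_; _≢_)

-- The real numbers, axiomatised as a complete ordered field.
-- (Any two models are isomorphic, so quantifying over all models is
-- the same as speaking about ℝ.)  The inverse is total, with 0⁻¹ = 0.

record RealField : Set₁ where
  infixl 6 _+_
  infixl 7 _*_
  infix  4 _≤_
  field
    R      : Set
    0# 1#  : R
    _+_ _*_ : R → R → R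
    -_     : R → R
    _⁻¹    : R → R
    _≤_    : R → R → Set
    +-assoc     : ∀ x y z → (x + y) + z ≡ x + (y + z)
    +-comm      : ∀ x y → x + y ≡ y + x
    +-identityˡ : ∀ x → 0# + x ≡ x
    +-inverseˡ  : ∀ x → (- x) + x ≡ 0#
    *-assoc     : ∀ x y z → (x * y) * z ≡ x * (y * z)
    *-comm      : ∀ x y → x * y ≡ y * x
    *-identityˡ : ∀ x → 1# * x ≡ x
    distribˡ    : ∀ x y z → x * (y + z) ≡ x * y + x * z
    0≢1         : 0# ≢ 1#
    *-inverseʳ  : ∀ x → x ≢ 0# → x * (x ⁻¹) ≡ 1#
    inv-zero    : 0# ⁻¹ ≡ 0#
    ≤-refl      : ∀ x → x ≤ x
    ≤-trans     : ∀ {x y z} → x ≤ y → y ≤ z → x ≤ z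
    ≤-antisym   : ∀ {x y} → x ≤ y → y ≤ x → x ≡ y
    ≤-total     : ∀ x y → (x ≤ y) ⊎ (y ≤ x)
    +-mono-≤    : ∀ {x y} z → x ≤ y → x + z ≤ y + z
    *-nonneg    : ∀ {x y} → 0# ≤ x → 0# ≤ y → 0# ≤ x * y
    complete    : (S : R → Set) → ∃ S → (∃ λ u → ∀ x → S x → x ≤ u) →
                  ∃ λ s → (∀ x → S x → x ≤ s) ×
                          (∀ u → (∀ x → S x → x ≤ u) → s ≤ u)

  fromℕ : ℕ → R
  fromℕ zero    = 0#
  fromℕ (suc n) = 1# + fromℕ n



module _ {n : ℕ} (Adj : Fin n → Fin n → Set) where
  data Walk : Fin n → Fin n → ℕ → Set where
    nil  : ∀ {x} → Walk x x 0
    cons : ∀ {x y z l} → Adj x y → Walk y z l → Walk x z (suc l)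

record DRG (n : ℕ) : Set₁ where
  field
    Adj        : Fin n → Fin n → Set
    Adj-sym    : ∀ {x y} → Adj x y → Adj y x
    Adj-irrefl : ∀ {x} → ¬ Adj x x
    -- ∂ is the path-length distance (this also encodes connectedness)
    ∂          : Fin n → Fin n → ℕ
    ∂-walk     : ∀ x y → Walk Adj x y (∂ x y)
    ∂-min      : ∀ {x y l} → Walk Adj x y l → ∂ x y ≤ℕ l
    D          : ℕ
    ∂≤D        : ∀ x y → ∂ x y ≤ℕ D
    D-attained : Σ (Fin n) λ x → Σ (Fin n) λ y → ∂ x y ≡ D
    p          : ℕ → ℕ → ℕ → ℕ
    regular    : ∀ h i j → h ≤ℕ D → i ≤ℕ D → j ≤ℕ D → ∀ x y → ∂ x y ≡ h →
                 length (filter (λ z → (∂ x z ≟ i) ×-dec (∂ y z ≟ j)) (allFin n))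
                   ≡ p h i j

  a b c : ℕ → ℕ
  a i = p i 1 i
  b i = p i 1 (suc i)
  c zero    = 0
  c (suc i) = p (suc i) 1 i

  k : ℕ
  k = b 0

module _ (ℝ : RealField) {n : ℕ} (Γ : DRG n) where
  open RealField ℝ
  open DRG Γ

  -- σ is the pseudo cosine sequence for θ (only σ 0 … σ D matter)
  IsPseudoCosine : R → (ℕ → R) → Set
  IsPseudoCosine θ σ =
    (σ 0 ≡ 1#) ×
    (∀ i → i < D →
      fromℕ (c i) * σ (i ∸ 1) + fromℕ (a i) * σ i + fromℕ (b i) * σ (suc i)
        ≡ θ * σ i)

  TightPair : R → R → Set
  TightPair θ θ′ =
    Σ (ℕ → R) λ σ → Σ (ℕ → R) λ ρ →
      IsPseudoCosine θ σ × IsPseudoCosine θ′ ρ ×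
      ∃ λ η → IsPseudoCosine η (λ i → σ i * ρ i)

-- Put s = σ₁ and r = ρ₁.  As a₀ = 0, c₁ = 1 and σ₀ = 1, the first two recurrences say
-- θ = k s and 1 + a₁ s + b₁ σ₂ = θ s; likewise for θ′, and for the product sequence, whose
-- eigenvalue is therefore k s r.  Multiplying the second recurrence of the product by b₁,
-- substituting b₁ σ₂ and b₁ ρ₂, and using k = 1 + a₁ + b₁ leaves (s − 1)(r − 1) F = 0 with
-- F = (a₁ + 1) θ θ′ + k (θ + θ′) + k (b₁ + 1).  Since θ, θ′ ≠ k we have s, r ≠ 1, hence F = 0,
-- and F is (a₁ + 1) times the difference of the two sides of the claimed identity.

module Submission where

open import Level using (0ℓ)
open import Algebra.Bundles using (CommutativeRing)
open import Data.Empty using (⊥-elim)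
open import Data.Fin using (Fin)
open import Data.List using (List; []; _∷_; length; filter; allFin)
open import Data.List.Membership.Propositional using (_∈_)
open import Data.List.Membership.Propositional.Properties using (∈-allFin)
open import Data.List.Properties using (filter-accept; filter-reject; filter-none; filter-≐)
open import Data.List.Relation.Unary.All as All using ()
open import Data.List.Relation.Unary.Any using (here; there)
open import Data.List.Relation.Unary.Unique.Propositional using (Unique; _∷_)
open import Data.List.Relation.Unary.Unique.Propositional.Properties using (allFin⁺)
open import Data.Nat using (ℕ; zero; suc; z≤n; s≤s) renaming (_≤_ to _≤ℕ_; _+_ to _+ℕ_)
open import Data.Nat.Properties using (_≟_)
import Data.Nat.Properties as ℕ
open import Data.Product using (Σ; _×_; _,_; proj₁)
open import Data.Sum using (inj₁; inj₂)
open import Function using (_∘_)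
open import Relation.Nullary using (¬_; yes; no)
open import Relation.Nullary.Decidable using (_×-dec_)
open import Relation.Unary using (Pred; Decidable)
open import Relation.Unary.Properties using (_∩?_)
open import Relation.Binary.PropositionalEquality
open ≡-Reasoning

open import Defs

module RealFieldProperties (ℝ : RealField) where
  open RealField ℝ

  commutativeRing : CommutativeRing 0ℓ 0ℓ
  commutativeRing = record
    { Carrier = R ; _≈_ = _≡_ ; _+_ = _+_ ; _*_ = _*_ ; -_ = -_ ; 0# = 0# ; 1# = 1#
    ; isCommutativeRing = record
      { isRing = record
        { +-isAbelianGroup = record
          { isGroup = record
            { isMonoid = record
              { isSemigroup = record
                { isMagma = record { isEquivalence = isEquivalence ; ∙-cong = cong₂ _+_ }
                ; assoc = +-assoc }
              ; identity = +-identityˡ , λ x → trans (+-comm x 0#) (+-identityˡ x) }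
            ; inverse = +-inverseˡ , λ x → trans (+-comm x (- x)) (+-inverseˡ x)
            ; ⁻¹-cong = cong -_ }
          ; comm = +-comm }
        ; *-cong = cong₂ _*_
        ; *-assoc = *-assoc
        ; *-identity = *-identityˡ , λ x → trans (*-comm x 1#) (*-identityˡ x)
        ; distrib = distribˡ , λ x y z → trans (*-comm (y + z) x)
                      (trans (distribˡ x y z) (cong₂ _+_ (*-comm x y) (*-comm x z))) }
      ; *-comm = *-comm } }

  open CommutativeRing commutativeRing using (-‿inverseʳ; ring; +-group; commutativeSemiring)
  open CommutativeRing commutativeRing public using (+-identityʳ; *-identityʳ; zeroˡ; zeroʳ)
  open import Algebra.Properties.Group +-group using (∙-cancelʳ; ⁻¹-involutive)
  open import Algebra.Properties.Group +-group public using (inverseˡ-unique; x∙y⁻¹≈ε⇒x≈y)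
  open import Algebra.Properties.Ring ring using (-1*x≈-x)
  open import Algebra.Solver.Ring.NaturalCoefficients.Default commutativeSemiring public
    using (solve; _:=_; _:+_; _:*_; con)

  x+u≡y+v∧u≡v⇒x≡y : ∀ {x y u v} → x + u ≡ y + v → u ≡ v → x ≡ y
  x+u≡y+v∧u≡v⇒x≡y {x} {y} {u} x+u≡y+v u≡v =
    ∙-cancelʳ u x y (trans x+u≡y+v (cong (y +_) (sym u≡v)))

  1+[x-1]≡x : ∀ x → 1# + (x + - 1#) ≡ x
  1+[x-1]≡x x = begin
    1# + (x + - 1#) ≡⟨ +-comm 1# _ ⟩
    x + - 1# + 1#   ≡⟨ +-assoc x (- 1#) 1# ⟩
    x + (- 1# + 1#) ≡⟨ cong (x +_) (+-inverseˡ 1#) ⟩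
    x + 0#          ≡⟨ +-identityʳ x ⟩
    x               ∎

  *-inverseˡ : ∀ {x} → x ≢ 0# → x ⁻¹ * x ≡ 1#
  *-inverseˡ {x} x≢0 = trans (*-comm (x ⁻¹) x) (*-inverseʳ x x≢0)

  *-cancelˡ-≢0 : ∀ {x y} → x ≢ 0# → x * y ≡ 0# → y ≡ 0#
  *-cancelˡ-≢0 {x} {y} x≢0 xy≡0 = begin
    y              ≡⟨ sym (*-identityˡ y) ⟩
    1# * y         ≡⟨ cong (_* y) (sym (*-inverseˡ x≢0)) ⟩
    x ⁻¹ * x * y   ≡⟨ *-assoc (x ⁻¹) x y ⟩
    x ⁻¹ * (x * y) ≡⟨ cong (x ⁻¹ *_) xy≡0 ⟩
    x ⁻¹ * 0#      ≡⟨ zeroʳ (x ⁻¹) ⟩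
    0#             ∎

  ⁻¹-unique : ∀ {x y} → x ≢ 0# → x * y ≡ 1# → x ⁻¹ ≡ y
  ⁻¹-unique {x} {y} x≢0 xy≡1 = begin
    x ⁻¹           ≡⟨ sym (*-identityʳ (x ⁻¹)) ⟩
    x ⁻¹ * 1#      ≡⟨ cong (x ⁻¹ *_) (sym xy≡1) ⟩
    x ⁻¹ * (x * y) ≡⟨ sym (*-assoc (x ⁻¹) x y) ⟩
    x ⁻¹ * x * y   ≡⟨ cong (_* y) (*-inverseˡ x≢0) ⟩
    1# * y         ≡⟨ *-identityˡ y ⟩
    y              ∎

  ⁻¹-square : ∀ {x} → x ≢ 0# → (x * x) ⁻¹ ≡ x ⁻¹ * x ⁻¹
  ⁻¹-square {x} x≢0 = ⁻¹-unique (x≢0 ∘ *-cancelˡ-≢0 x≢0) (begin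
    x * x * (x ⁻¹ * x ⁻¹)     ≡⟨ interchange x (x ⁻¹) ⟩
    x * x ⁻¹ * (x * x ⁻¹)     ≡⟨ cong₂ _*_ (*-inverseʳ x x≢0) (*-inverseʳ x x≢0) ⟩
    1# * 1#                   ≡⟨ *-identityˡ 1# ⟩
    1#                        ∎)
    where
    interchange : ∀ x y → x * x * (y * y) ≡ x * y * (x * y)
    interchange = solve 2 (λ x y → x :* x :* (y :* y) := x :* y :* (x :* y)) refl

  0≤1 : 0# ≤ 1#
  0≤1 with ≤-total 0# 1#
  ... | inj₁ 0≤1 = 0≤1
  ... | inj₂ 1≤0 = ⊥-elim (0≢1 (≤-antisym 0≤1′ 1≤0))
    where
    0≤-1 : 0# ≤ - 1#
    0≤-1 = subst₂ _≤_ (-‿inverseʳ 1#) (+-identityˡ (- 1#)) (+-mono-≤ (- 1#) 1≤0)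
    0≤1′ : 0# ≤ 1#
    0≤1′ = subst (0# ≤_) (trans (-1*x≈-x (- 1#)) (⁻¹-involutive 1#)) (*-nonneg 0≤-1 0≤-1)

  1≤x+1 : ∀ {x} → 0# ≤ x → 1# ≤ x + 1#
  1≤x+1 {x} 0≤x = subst (_≤ x + 1#) (+-identityˡ 1#) (+-mono-≤ 1# 0≤x)

  fromℕ-nonneg : ∀ n → 0# ≤ fromℕ n
  fromℕ-nonneg zero    = ≤-refl 0#
  fromℕ-nonneg (suc n) = ≤-trans 0≤1 (subst (1# ≤_) (+-comm (fromℕ n) 1#) (1≤x+1 (fromℕ-nonneg n)))

  fromℕ+1≢0 : ∀ n → fromℕ n + 1# ≢ 0#
  fromℕ+1≢0 n eq = 0≢1 (≤-antisym 0≤1 (subst (1# ≤_) eq (1≤x+1 (fromℕ-nonneg n))))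

  fromℕ-+ : ∀ m n → fromℕ (m +ℕ n) ≡ fromℕ m + fromℕ n
  fromℕ-+ zero    n = sym (+-identityˡ (fromℕ n))
  fromℕ-+ (suc m) n = trans (cong (1# +_) (fromℕ-+ m n)) (sym (+-assoc 1# (fromℕ m) (fromℕ n)))

module _ {A : Set} {P : Pred A 0ℓ} (P? : Decidable P) where

  length-filter-unique : ∀ {xs y} → Unique xs → y ∈ xs → P y → (∀ {z} → P z → z ≡ y) →
                         length (filter P? xs) ≡ 1
  length-filter-unique {x ∷ xs} (x≢xs ∷ _) (here refl) Py only-y = begin
    length (filter P? (x ∷ xs)) ≡⟨ cong length (filter-accept P? Py) ⟩
    suc (length (filter P? xs)) ≡⟨ cong (suc ∘ length) (filter-none P? none) ⟩
    1                           ∎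
    where
    none : All.All (λ z → ¬ P z) xs
    none = All.map (λ x≢z Pz → x≢z (sym (only-y Pz))) x≢xs
  length-filter-unique (x≢xs ∷ xs-unique) (there y∈xs) Py only-y =
    trans (cong length (filter-reject P? (λ Px → All.lookup x≢xs y∈xs (only-y Px))))
          (length-filter-unique xs-unique y∈xs Py only-y)

  length-filter-split₃ : (f : A → ℕ) → (∀ {z} → P z → f z ≤ℕ 2) → ∀ xs →
    length (filter P? xs) ≡
      length (filter (P? ∩? λ z → f z ≟ 0) xs) +ℕ
      length (filter (P? ∩? λ z → f z ≟ 1) xs) +ℕ
      length (filter (P? ∩? λ z → f z ≟ 2) xs)
  length-filter-split₃ f f≤2 [] = refl
  length-filter-split₃ f f≤2 (z ∷ zs) with ih ← length-filter-split₃ f f≤2 zs | P? z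
  ... | no _ = ih
  ... | yes Pz with f z | f≤2 Pz
  ...   | 0 | _ = cong suc ih
  ...   | 1 | _ = trans (cong suc ih) (sym (cong (_+ℕ count 2) (ℕ.+-suc (count 0) (count 1))))
    where
    count : ℕ → ℕ
    count j = length (filter (P? ∩? λ z → f z ≟ j) zs)
  ...   | 2 | _ = trans (cong suc ih) (sym (ℕ.+-suc _ _))
  ...   | suc (suc (suc _)) | s≤s (s≤s ())

module _ {n : ℕ} (Γ : DRG n) where
  open DRG Γ

  ∂-refl : ∀ x → ∂ x x ≡ 0
  ∂-refl x = ℕ.n≤0⇒n≡0 (∂-min (nil {Adj = Adj}))

  ∂≡0⇒≡ : ∀ {x y} → ∂ x y ≡ 0 → x ≡ y
  ∂≡0⇒≡ {x} {y} ∂xy≡0 = walk₀ (subst (Walk Adj x y) ∂xy≡0 (∂-walk x y))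
    where
    walk₀ : ∀ {u v} → Walk Adj u v 0 → u ≡ v
    walk₀ nil = refl

  Adj⇒∂≡1 : ∀ {x y} → Adj x y → ∂ x y ≡ 1
  Adj⇒∂≡1 {x} {y} x∼y with ∂ x y in ∂xy | ∂-min (cons x∼y (nil {Adj = Adj}))
  ... | 0           | _       = ⊥-elim (Adj-irrefl (subst (Adj x) (sym (∂≡0⇒≡ ∂xy)) x∼y))
  ... | 1           | _       = refl
  ... | suc (suc _) | s≤s ()

  ∂-Adj-≤ : ∀ {x y} z → Adj x y → ∂ y z ≤ℕ suc (∂ x z)
  ∂-Adj-≤ {x} z x∼y = ∂-min (cons (Adj-sym x∼y) (∂-walk x z))

  adjacent-pair : 1 ≤ℕ D → Σ (Fin n) λ x → Σ (Fin n) λ y → Adj x y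
  adjacent-pair 1≤D with D-attained
  ... | x , y , ∂xy≡D = x , first-step (∂-walk x y) (subst (1 ≤ℕ_) (sym ∂xy≡D) 1≤D)
    where
    first-step : ∀ {u v l} → Walk Adj u v l → 1 ≤ℕ l → Σ (Fin n) (Adj u)
    first-step (cons u∼w _) _ = _ , u∼w

  a₀≡0 : 1 ≤ℕ D → a 0 ≡ 0
  a₀≡0 1≤D with D-attained
  ... | x , _ = trans (sym (regular 0 1 0 z≤n 1≤D z≤n x x (∂-refl x)))
                      (cong length (filter-none _ (All.universal not-both (allFin n))))
    where
    not-both : ∀ z → ¬ (∂ x z ≡ 1 × ∂ x z ≡ 0)
    not-both z (∂xz≡1 , ∂xz≡0) = ℕ.0≢1+n (trans (sym ∂xz≡0) ∂xz≡1)

  c₁≡1 : 1 ≤ℕ D → c 1 ≡ 1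
  c₁≡1 1≤D with adjacent-pair 1≤D
  ... | x , y , x∼y =
    trans (sym (regular 1 1 0 1≤D 1≤D z≤n x y (Adj⇒∂≡1 x∼y)))
          (length-filter-unique _ (allFin⁺ n) (∈-allFin y) (Adj⇒∂≡1 x∼y , ∂-refl y)
                                (λ (_ , ∂yz≡0) → sym (∂≡0⇒≡ ∂yz≡0)))

  k≡c₁+a₁+b₁ : 2 ≤ℕ D → k ≡ c 1 +ℕ a 1 +ℕ b 1
  k≡c₁+a₁+b₁ 2≤D with adjacent-pair (ℕ.<⇒≤ 2≤D)
  ... | x , y , x∼y = begin
    k                                                       ≡⟨ sym (regular 0 1 1 z≤n 1≤D 1≤D x x (∂-refl x)) ⟩
    length (filter (λ z → (∂ x z ≟ 1) ×-dec (∂ x z ≟ 1)) V) ≡⟨ cong length (filter-≐ _ _ (proj₁ , λ e → e , e) V) ⟩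
    length (filter (λ z → ∂ x z ≟ 1) V)                     ≡⟨ length-filter-split₃ _ (∂ y) ∂y≤2 V ⟩
    count 0 +ℕ count 1 +ℕ count 2                           ≡⟨ cong₂ _+ℕ_ (cong₂ _+ℕ_ (count≡p₁₁ z≤n) (count≡p₁₁ 1≤D)) (count≡p₁₁ 2≤D) ⟩
    c 1 +ℕ a 1 +ℕ b 1                                       ∎
    where
    1≤D : 1 ≤ℕ D
    1≤D = ℕ.<⇒≤ 2≤D
    V : List (Fin n)
    V = allFin n
    count : ℕ → ℕ
    count j = length (filter (λ z → (∂ x z ≟ 1) ×-dec (∂ y z ≟ j)) V)
    count≡p₁₁ : ∀ {j} → j ≤ℕ D → count j ≡ p 1 1 j
    count≡p₁₁ j≤D = regular 1 1 _ 1≤D 1≤D j≤D x y (Adj⇒∂≡1 x∼y)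
    ∂y≤2 : ∀ {z} → ∂ x z ≡ 1 → ∂ y z ≤ℕ 2
    ∂y≤2 {z} ∂xz≡1 = subst (λ l → ∂ y z ≤ℕ suc l) ∂xz≡1 (∂-Adj-≤ z x∼y)

module _ (ℝ : RealField) {n : ℕ} (Γ : DRG n) where
  open RealField ℝ
  open DRG Γ
  open RealFieldProperties ℝ

  k*σ₁≡θ : ∀ {θ σ} → 1 ≤ℕ D → IsPseudoCosine ℝ Γ θ σ → fromℕ k * σ 1 ≡ θ
  k*σ₁≡θ {θ} {σ} 1≤D (σ₀≡1 , recurrence) = begin
    fromℕ k * σ 1                                         ≡⟨ sym (+-identityˡ _) ⟩
    0# + fromℕ k * σ 1                                    ≡⟨ cong (_+ fromℕ k * σ 1) (sym vanishing) ⟩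
    0# * σ 0 + fromℕ (a 0) * σ 0 + fromℕ k * σ 1          ≡⟨ recurrence 0 1≤D ⟩
    θ * σ 0                                               ≡⟨ cong (θ *_) σ₀≡1 ⟩
    θ * 1#                                                ≡⟨ *-identityʳ θ ⟩
    θ                                                     ∎
    where
    vanishing : 0# * σ 0 + fromℕ (a 0) * σ 0 ≡ 0#
    vanishing = begin
      0# * σ 0 + fromℕ (a 0) * σ 0 ≡⟨ cong (λ i → 0# * σ 0 + fromℕ i * σ 0) (a₀≡0 Γ 1≤D) ⟩
      0# * σ 0 + 0# * σ 0          ≡⟨ cong₂ _+_ (zeroˡ (σ 0)) (zeroˡ (σ 0)) ⟩
      0# + 0#                      ≡⟨ +-identityˡ 0# ⟩
      0#                           ∎

  1+a₁σ₁+b₁σ₂≡θσ₁ : ∀ {θ σ} → 2 ≤ℕ D → IsPseudoCosine ℝ Γ θ σ →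
                  1# + fromℕ (a 1) * σ 1 + fromℕ (b 1) * σ 2 ≡ θ * σ 1
  1+a₁σ₁+b₁σ₂≡θσ₁ {θ} {σ} 2≤D (σ₀≡1 , recurrence) =
    trans (cong (λ t → t + fromℕ (a 1) * σ 1 + fromℕ (b 1) * σ 2) (sym c₁σ₀≡1)) (recurrence 1 2≤D)
    where
    c₁σ₀≡1 : fromℕ (c 1) * σ 0 ≡ 1#
    c₁σ₀≡1 = begin
      fromℕ (c 1) * σ 0 ≡⟨ cong₂ (λ i t → fromℕ i * t) (c₁≡1 Γ (ℕ.<⇒≤ 2≤D)) σ₀≡1 ⟩
      (1# + 0#) * 1#    ≡⟨ *-identityʳ _ ⟩
      1# + 0#           ≡⟨ +-identityʳ 1# ⟩
      1#                ∎

  fromℕk≡1+a₁+b₁ : 2 ≤ℕ D → fromℕ k ≡ 1# + fromℕ (a 1) + fromℕ (b 1)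
  fromℕk≡1+a₁+b₁ 2≤D = begin
    fromℕ k                                   ≡⟨ cong fromℕ (k≡c₁+a₁+b₁ Γ 2≤D) ⟩
    fromℕ (c 1 +ℕ a 1 +ℕ b 1)                 ≡⟨ fromℕ-+ (c 1 +ℕ a 1) (b 1) ⟩
    fromℕ (c 1 +ℕ a 1) + fromℕ (b 1)          ≡⟨ cong (_+ fromℕ (b 1)) (fromℕ-+ (c 1) (a 1)) ⟩
    fromℕ (c 1) + fromℕ (a 1) + fromℕ (b 1)   ≡⟨ cong (λ i → fromℕ i + fromℕ (a 1) + fromℕ (b 1)) (c₁≡1 Γ (ℕ.<⇒≤ 2≤D)) ⟩
    1# + 0# + fromℕ (a 1) + fromℕ (b 1)       ≡⟨ cong (λ t → t + fromℕ (a 1) + fromℕ (b 1)) (+-identityʳ 1#) ⟩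
    1# + fromℕ (a 1) + fromℕ (b 1)            ∎

module TightPairAlgebra (ℝ : RealField) where
  open RealField ℝ
  open RealFieldProperties ℝ

  tightPairForm : (K A B θ θ′ : R) → R
  tightPairForm K A B θ θ′ = (A + 1#) * (θ * θ′) + K * (θ + θ′) + K * (B + 1#)

  -- X₀ = K s² − 1 − A s is the value of B P forced by the first recurrence, and with
  -- F = tightPairForm K A B θ θ′ one has α β F = K (B (L₃ − R₃) − B Q (L₁ − R₁) − X₀ (L₂ − R₂))
  -- for the three recurrences Lᵢ ≡ Rᵢ; `combination` is this identity with the negative terms
  -- moved across.  In α = s − 1 and β = r − 1 it is free of subtraction, as the solver needs.
  tight-factorisation : ∀ {K A B θ θ′ η s r P Q α β} →
    K ≡ 1# + A + B → s ≡ 1# + α → r ≡ 1# + β →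
    θ ≡ K * s → θ′ ≡ K * r → η ≡ K * (s * r) →
    1# + A * s + B * P ≡ θ * s →
    1# + A * r + B * Q ≡ θ′ * r →
    1# + A * (s * r) + B * (P * Q) ≡ η * (s * r) →
    α * (β * tightPairForm K A B θ θ′) ≡ 0#
  tight-factorisation {A = A} {B} {P = P} {Q} {α} {β} refl refl refl refl refl refl σ-rec ρ-rec στ-rec =
    x+u≡y+v∧u≡v⇒x≡y (combination A B α β P Q)
      (cong (K *_) (cong₂ _+_ (cong₂ _+_ (cong (B *_) (sym στ-rec)) (cong (B * Q *_) σ-rec))
                              (cong (X₀ *_) ρ-rec)))
    where
    K X₀ : R
    K = 1# + A + B
    X₀ = B + α * (K + 1# + B + K * α)
    combination : ∀ A B α β P Q →
      let K = 1# + A + B ; s = 1# + α ; r = 1# + β ; X₀ = B + α * (K + 1# + B + K * α) in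
      α * (β * tightPairForm K A B (K * s) (K * r))
        + K * (B * (K * (s * r) * (s * r)) + B * Q * (1# + A * s + B * P) + X₀ * (1# + A * r + B * Q))
      ≡ 0# + K * (B * (1# + A * (s * r) + B * (P * Q)) + B * Q * (K * s * s) + X₀ * (K * r * r))
    combination = solve 6 (λ A B α β P Q →
      let K = con 1 :+ A :+ B ; s = con 1 :+ α ; r = con 1 :+ β
          X₀ = B :+ α :* (K :+ con 1 :+ B :+ K :* α)
          θ = K :* s ; θ′ = K :* r
          F = (A :+ con 1) :* (θ :* θ′) :+ K :* (θ :+ θ′) :+ K :* (B :+ con 1)
      in α :* (β :* F)
           :+ K :* (B :* (K :* (s :* r) :* (s :* r)) :+ B :* Q :* (con 1 :+ A :* s :+ B :* P)
                    :+ X₀ :* (con 1 :+ A :* r :+ B :* Q))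
         := con 0 :+ K :* (B :* (con 1 :+ A :* (s :* r) :+ B :* (P :* Q)) :+ B :* Q :* (K :* s :* s)
                           :+ X₀ :* (K :* r :* r))) refl

  tightPairForm≡0⇒ : ∀ {K A B θ θ′} → K ≡ 1# + A + B → A + 1# ≢ 0# → tightPairForm K A B θ θ′ ≡ 0# →
    (θ + K * (A + 1#) ⁻¹) * (θ′ + K * (A + 1#) ⁻¹) ≡ - (K * A * B * ((A + 1#) * (A + 1#)) ⁻¹)
  tightPairForm≡0⇒ {A = A} {B} {θ} {θ′} refl A+1≢0 form≡0 = begin
    (θ + K * w) * (θ′ + K * w)               ≡⟨ inverseˡ-unique _ _ sum≡0 ⟩
    - (K * A * B * (w * w))                  ≡⟨ cong (λ t → - (K * A * B * t)) (sym (⁻¹-square A+1≢0)) ⟩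
    - (K * A * B * ((A + 1#) * (A + 1#)) ⁻¹) ∎
    where
    K w : R
    K = 1# + A + B
    w = (A + 1#) ⁻¹
    [A+1]w≡1 : (A + 1#) * w ≡ 1#
    [A+1]w≡1 = *-inverseʳ (A + 1#) A+1≢0
    -- The identity only holds modulo (A + 1) w = 1, which enters through the last summands.
    identity : ∀ A B θ θ′ w →
      let K = 1# + A + B ; m = A + 1# in
      (θ + K * w) * (θ′ + K * w) + K * A * B * (w * w) + (θ * θ′ * (m * w) + K * w * (B + 1#) * 1#)
      ≡ w * tightPairForm K A B θ θ′ + (θ * θ′ * 1# + K * w * (B + 1#) * (m * w))
    identity = solve 5 (λ A B θ θ′ w →
      let K = con 1 :+ A :+ B ; m = A :+ con 1
          F = m :* (θ :* θ′) :+ K :* (θ :+ θ′) :+ K :* (B :+ con 1)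
      in (θ :+ K :* w) :* (θ′ :+ K :* w) :+ K :* A :* B :* (w :* w)
           :+ (θ :* θ′ :* (m :* w) :+ K :* w :* (B :+ con 1) :* con 1)
         := w :* F :+ (θ :* θ′ :* con 1 :+ K :* w :* (B :+ con 1) :* (m :* w))) refl
    sum≡0 : (θ + K * w) * (θ′ + K * w) + K * A * B * (w * w) ≡ 0#
    sum≡0 = begin
      (θ + K * w) * (θ′ + K * w) + K * A * B * (w * w)
        ≡⟨ x+u≡y+v∧u≡v⇒x≡y (identity A B θ θ′ w)
             (cong₂ (λ u v → θ * θ′ * u + K * w * (B + 1#) * v) [A+1]w≡1 (sym [A+1]w≡1)) ⟩
      w * tightPairForm K A B θ θ′ ≡⟨ cong (w *_) form≡0 ⟩
      w * 0#                       ≡⟨ zeroʳ w ⟩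
      0#                           ∎

lemma4p4 : (ℝ : RealField) → ∀ {n} (Γ : DRG n) →
    let open RealField ℝ
        open DRG Γ
    in 3 ≤ℕ D → (θ θ′ : R) → θ ≢ fromℕ k → θ′ ≢ fromℕ k →
       TightPair ℝ Γ θ θ′ →
       (θ + fromℕ k * (fromℕ (a 1) + 1#) ⁻¹) * (θ′ + fromℕ k * (fromℕ (a 1) + 1#) ⁻¹)
         ≡ - (fromℕ k * fromℕ (a 1) * fromℕ (b 1) * ((fromℕ (a 1) + 1#) * (fromℕ (a 1) + 1#)) ⁻¹)
lemma4p4 ℝ Γ 3≤D θ θ′ θ≢k θ′≢k (σ , ρ , σ-cos , ρ-cos , η , στ-cos) =
  tightPairForm≡0⇒ K≡1+a₁+b₁ (fromℕ+1≢0 (a 1)) form≡0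
  where
  open RealField ℝ
  open DRG Γ
  open RealFieldProperties ℝ
  open TightPairAlgebra ℝ
  2≤D : 2 ≤ℕ D
  2≤D = ℕ.<⇒≤ 3≤D
  1≤D : 1 ≤ℕ D
  1≤D = ℕ.<⇒≤ 2≤D
  K : R
  K = fromℕ k
  K≡1+a₁+b₁ : K ≡ 1# + fromℕ (a 1) + fromℕ (b 1)
  K≡1+a₁+b₁ = fromℕk≡1+a₁+b₁ ℝ Γ 2≤D
  θ≡Kσ₁ : θ ≡ K * σ 1
  θ≡Kσ₁ = sym (k*σ₁≡θ ℝ Γ 1≤D σ-cos)
  θ′≡Kρ₁ : θ′ ≡ K * ρ 1
  θ′≡Kρ₁ = sym (k*σ₁≡θ ℝ Γ 1≤D ρ-cos)
  η≡Kσ₁ρ₁ : η ≡ K * (σ 1 * ρ 1)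
  η≡Kσ₁ρ₁ = sym (k*σ₁≡θ ℝ Γ 1≤D στ-cos)
  factorised : (σ 1 + - 1#) * ((ρ 1 + - 1#) * tightPairForm K (fromℕ (a 1)) (fromℕ (b 1)) θ θ′) ≡ 0#
  factorised = tight-factorisation K≡1+a₁+b₁ (sym (1+[x-1]≡x (σ 1))) (sym (1+[x-1]≡x (ρ 1)))
                 θ≡Kσ₁ θ′≡Kρ₁ η≡Kσ₁ρ₁
                 (1+a₁σ₁+b₁σ₂≡θσ₁ ℝ Γ 2≤D σ-cos) (1+a₁σ₁+b₁σ₂≡θσ₁ ℝ Γ 2≤D ρ-cos)
                 (1+a₁σ₁+b₁σ₂≡θσ₁ ℝ Γ 2≤D στ-cos)
  s-1≢0 : ∀ {ϑ s} → ϑ ≢ K → ϑ ≡ K * s → s + - 1# ≢ 0#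
  s-1≢0 ϑ≢K ϑ≡Ks s-1≡0 = ϑ≢K (trans ϑ≡Ks (trans (cong (K *_) (x∙y⁻¹≈ε⇒x≈y _ _ s-1≡0)) (*-identityʳ K)))
  form≡0 : tightPairForm K (fromℕ (a 1)) (fromℕ (b 1)) θ θ′ ≡ 0#
  form≡0 = *-cancelˡ-≢0 (s-1≢0 θ′≢k θ′≡Kρ₁) (*-cancelˡ-≢0 (s-1≢0 θ≢k θ≡Kσ₁) factorised)
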